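{- Let $T[1..n]$ be a string as described in the context and let $r$ be the number of runs of its BWT $\mathsf{L}$. Then the total number of net occurrences in $T$, i.e. $\sum_{x}\mathsf{NF}(x)$ where $x$ ranges over all repeats of $T$ (including the empty string), is less than $2r$.
   Context: Alphabet $\Sigma_{\$}=[1..\sigma]$ is ordered with smallest character $\$$. $T[1..n]$ ($n\ge 2$) contains every character of $\Sigma_{\$}$, $T[n]=\$$, $\$$ does not occur in $T[1..n-1]$, and by convention $T[0]=\$$. A position $b\in[1..n]$ is an occurrence of $x$ if $T[b..b+|x|-1]=x$; $\mathsf{Occ}(x)$ is the set of occurrences. $x$ is a repeat if $|\mathsf{Occ}(x)|\ge 2$ and unique if $|\mathsf{Occ}(x)|=1$; by convention the empty string $\varepsilon$ is a repeat with $\mathsf{Occ}(\varepsilon)=[1..n]$. An occurrence $b$ of a nonempty repeat $x$ is a net occurrence if there is no occurrence $b'$ of another repeat $x'$ with $[b..b+|x|)\subsetneq[b'..b'+|x'|)$; for $\varepsilon$, an occurrence $b$ is a net occurrence iff the one-character strings $T[b-1]$ and $T[b]$ are both unique in $T$. $\mathsf{NF}(x)$ (net frequency) is the number of net occurrences of $x$. The suffix array $\mathsf{SA}[1..n]$ is the permutation with $T[\mathsf{SA}[i]..n]$ the lexicographically $i$-th nonempty suffix, and the BWT is the string $\mathsf{L}[i]=T[\mathsf{SA}[i]-1]$. A run of $\mathsf{L}$ is a maximal block of equal consecutive characters; $r$ is the number of runs. -}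

module Defs where

open import Data.Nat using (ℕ; zero; suc; _+_; _*_; _∸_; _≤_; _<_; _≟_; _≤?_; _<?_)
open import Data.Nat.Properties using () renaming (_≟_ to _≟ℕ_)
open import Data.List using (List; []; _∷_; [_]; length; take; drop; map; filter; upTo; concatMap; deduplicate; _++_)
open import Data.List.Properties using (≡-dec)
open import Data.Nat.ListAction using (sum)
open import Data.List.Relation.Unary.Any using (Any; any?)
open import Data.List.Relation.Unary.Linked using (Linked)
open import Data.List.Relation.Binary.Lex.Strict using (Lex-<)
open import Data.List.Relation.Binary.Permutation.Propositional using (_↭_)
open import Data.Product using (_×_)
open import Data.Sum using (_⊎_)
open import Relation.Nullary using (¬_; Dec; yes; no)
open import Relation.Nullary.Decidable using (_×-dec_; _⊎-dec_; ¬?)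
open import Relation.Binary.PropositionalEquality using (_≡_)

-- Strings are lists of naturals; the alphabet is [1..σ] and the
-- smallest character $ is 1.

Str : Set
Str = List ℕ

dollar : ℕ
dollar = 1

_≟s_ : (x y : Str) → Dec (x ≡ y)
_≟s_ = ≡-dec _≟ℕ_

-- 0-indexed lookup with a dummy default (only used in range)
nth : Str → ℕ → ℕ
nth []       _       = dollar
nth (c ∷ _)  zero    = c
nth (_ ∷ cs) (suc i) = nth cs i

-- 1-indexed character T[i], with the convention T[0] = $
charAt : Str → ℕ → ℕ
charAt T zero    = dollar
charAt T (suc i) = nth T i

positions : Str → List ℕ
positions T = map suc (upTo (length T))

-- substring T[b..b+ℓ-1] (1-indexed start b)
sub : Str → ℕ → ℕ → Str
sub T b ℓ = take ℓ (drop (b ∸ 1) T)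

-- b is an occurrence of x: T[b..b+|x|-1] = x  (with b ∈ [1..n] imposed
-- by only ever ranging b over  positions T)
OccAt : Str → Str → ℕ → Set
OccAt T x b = sub T b (length x) ≡ x

occAt? : ∀ T x b → Dec (OccAt T x b)
occAt? T x b = sub T b (length x) ≟s x

Occ : Str → Str → List ℕ
Occ T x = filter (occAt? T x) (positions T)

Repeat : Str → Str → Set
Repeat T x = 2 ≤ length (Occ T x)

repeat? : ∀ T x → Dec (Repeat T x)
repeat? T x = 2 ≤? length (Occ T x)

Unique : Str → Str → Set
Unique T x = length (Occ T x) ≡ 1

unique? : ∀ T x → Dec (Unique T x)
unique? T x = length (Occ T x) ≟ 1

-- x' := T[b'..b'+ℓ'-1] is a repeat occurring at b' whose interval
-- [b'..b'+ℓ') strictly contains [b..b+|x|)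
Covers : Str → Str → ℕ → ℕ → ℕ → Set
Covers T x b b' ℓ' =
  OccAt T (sub T b' ℓ') b' × Repeat T (sub T b' ℓ') ×
  b' ≤ b × b + length x ≤ b' + ℓ' × (b' < b ⊎ b + length x < b' + ℓ')

covers? : ∀ T x b b' ℓ' → Dec (Covers T x b b' ℓ')
covers? T x b b' ℓ' =
  occAt? T (sub T b' ℓ') b' ×-dec repeat? T (sub T b' ℓ') ×-dec
  (b' ≤? b) ×-dec (b + length x ≤? b' + ℓ') ×-dec
  ((b' <? b) ⊎-dec (b + length x <? b' + ℓ'))

-- some occurrence b' ∈ [1..n] of some repeat x' (every string occurring at
-- b' is T[b'..b'+ℓ'-1] for some ℓ' ≤ n) strictly covers [b..b+|x|)
Covered : Str → Str → ℕ → Set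
Covered T x b = Any (λ b' → Any (λ ℓ' → Covers T x b b' ℓ') (upTo (suc (length T)))) (positions T)

covered? : ∀ T x b → Dec (Covered T x b)
covered? T x b = any? (λ b' → any? (λ ℓ' → covers? T x b b' ℓ') (upTo (suc (length T)))) (positions T)

-- b is a net occurrence of x (b is assumed to be an occurrence of x)
NetCond : Str → Str → ℕ → Set
NetCond T []        b = Unique T [ charAt T (b ∸ 1) ] × Unique T [ charAt T b ]
NetCond T x@(_ ∷ _) b = ¬ Covered T x b

netCond? : ∀ T x b → Dec (NetCond T x b)
netCond? T []        b = unique? T [ charAt T (b ∸ 1) ] ×-dec unique? T [ charAt T b ]
netCond? T x@(_ ∷ _) b = ¬? (covered? T x b)

NetOcc : Str → Str → ℕ → Set
NetOcc T x b = OccAt T x b × NetCond T x b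

netOcc? : ∀ T x b → Dec (NetOcc T x b)
netOcc? T x b = occAt? T x b ×-dec netCond? T x b

NF : Str → Str → ℕ
NF T x = length (filter (netOcc? T x) (positions T))

substrings : Str → List Str
substrings T = deduplicate _≟s_
  (concatMap (λ b → map (sub T b) (upTo (suc (length T)))) (positions T))

-- the repeats of T (every repeat occurs, hence is a substring)
repeats : Str → List Str
repeats T = filter (repeat? T) (substrings T)

totalNF : Str → ℕ
totalNF T = sum (map (NF T) (repeats T))

suffix : Str → ℕ → Str
suffix T i = drop (i ∸ 1) T

_<lex_ : Str → Str → Set
_<lex_ = Lex-< _≡_ _<_

IsSuffixArray : Str → List ℕ → Set
IsSuffixArray T SA = (SA ↭ positions T) × Linked (λ i j → suffix T i <lex suffix T j) SA

BWT : Str → List ℕ → Str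
BWT T SA = map (λ i → charAt T (i ∸ 1)) SA

changes : ℕ → Str → ℕ
changes a []       = 0
changes a (b ∷ cs) with a ≟ b
... | yes _ = changes b cs
... | no  _ = suc (changes b cs)

runs : Str → ℕ
runs []       = 0
runs (a ∷ cs) = suc (changes a cs)

open import Data.List.Membership.Propositional using (_∈_)
open import Data.List.Relation.Unary.All using (All)

ValidText : ℕ → Str → Set
ValidText σ T =
  2 ≤ length T ×
  All (λ c → 1 ≤ c × c ≤ σ) T ×
  (∀ c → 1 ≤ c → c ≤ σ → c ∈ T) ×
  Data.Product.∃ (λ U → T ≡ U ++ [ dollar ] × ¬ (dollar ∈ U))

-- At each position b at most one repeat has a net occurrence: of two nonempty ones the longer
-- would cover the shorter, and the empty string can only be net at b if T[b] is unique.  If x has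
-- a net occurrence at b, it occurs at some other position too, so in suffix-array order x is also
-- a prefix of the suffix next to b on that side.  Were the BWT letter c of that neighbour equal to
-- the one of b, then cx would be a repeat covering x at b (for x = ε: c would not be unique, and
-- $ = T[0] = T[n] handles b = 1).  So every net occurrence is charged to a run boundary of L next
-- to it, each of the r - 1 boundaries receives at most two charges, and the total is at most
-- 2(r - 1) < 2r.

module Submission where

open import Defs
open import Data.Nat using (ℕ; _*_; _<_)
open import Data.List using (List)

open import Data.Nat using (zero; suc; _+_; _∸_; _⊓_; _≤_; z≤n; s≤s; _≟_)
open import Data.Nat.Properties
open import Data.Nat.ListAction using (sum)
open import Data.List using ([]; _∷_; [_]; length; concatMap; take; drop; map; filter; upTo; head; _++_)
open import Data.List.Properties using (∷-injective; length-take; length-drop; map-cong; filter-none)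
open import Data.List.Relation.Unary.Any using (here; there; any?)
open import Data.List.Relation.Unary.All.Properties using (¬Any⇒All¬)
open import Data.List.Relation.Unary.AllPairs using (_∷_)
open import Data.List.Relation.Unary.Linked using (Linked; [-]; _∷_)
open import Data.List.Relation.Unary.Linked.Properties using (Linked⇒AllPairs)
open import Data.List.Relation.Unary.All using (_∷_)
import Data.List.Relation.Unary.All as All
open import Data.List.Relation.Binary.Lex.Strict using (halt; this; next; xs≮[]; <-irreflexive; <-transitive)
import Data.List.Relation.Binary.Pointwise.Properties as Pointwise
open import Data.List.Relation.Binary.Permutation.Propositional using (_↭_; ↭-sym)
open import Data.List.Relation.Binary.Permutation.Propositional.Properties using (filter-↭; ↭-length; ∈-resp-↭)
open import Data.List.Membership.Propositional using (_∈_; find; lose)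
open import Data.List.Membership.Propositional.Properties using (∈-filter⁺; ∈-filter⁻; ∈-upTo⁺; ∈-upTo⁻; ∈-map⁺; ∈-map⁻)
open import Data.List.Relation.Unary.Unique.Propositional using () renaming (Unique to Distinct)
import Data.List.Relation.Unary.Unique.Propositional.Properties as Distinct
open import Data.List.Relation.Unary.Unique.DecPropositional.Properties _≟s_ using (deduplicate-!)
open import Data.Maybe using (Maybe; just; nothing)
open import Data.Maybe.Relation.Unary.All using (just; nothing) renaming (All to AllMaybe)
open import Data.Maybe.Relation.Unary.Any using (just) renaming (Any to AnyMaybe)
open import Data.Product using (∃; _×_; _,_; proj₁; proj₂)
open import Data.Sum using (_⊎_; inj₁; inj₂)
open import Function using (_∘_)
open import Relation.Nullary using (¬_; Dec; yes; no; contradiction)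
open import Relation.Binary.Definitions using (Transitive; tri<; tri≈; tri>)
open import Relation.Binary.PropositionalEquality using (_≡_; _≢_; refl; sym; trans; cong; subst; isEquivalence; ≢-sym; module ≡-Reasoning)
open import Data.Nat.Tactic.RingSolver using (solve-∀)
open import Algebra.Properties.CommutativeSemigroup +-commutativeSemigroup using () renaming (x∙yz≈y∙xz to +-left-comm)

module _ {A : Set} where

  0<length : ∀ {v} {xs : List A} → v ∈ xs → 0 < length xs
  0<length {xs = _ ∷ _} _ = s≤s z≤n

  2≤length : ∀ {u v} {xs : List A} → u ∈ xs → v ∈ xs → u ≢ v → 2 ≤ length xs
  2≤length (here refl) (here refl) u≢v = contradiction refl u≢v
  2≤length (here refl) (there v∈xs) _   = s≤s (0<length v∈xs)
  2≤length (there u∈xs) (here refl) _   = s≤s (0<length u∈xs)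
  2≤length (there u∈xs) (there v∈xs) u≢v = m≤n⇒m≤1+n (2≤length u∈xs v∈xs u≢v)

  length≤1 : ∀ {xs : List A} → Distinct xs → (∀ {a c} → a ∈ xs → c ∈ xs → a ≡ c) → length xs ≤ 1
  length≤1 {[]}         _                  _   = z≤n
  length≤1 {_ ∷ []}     _                  _   = s≤s z≤n
  length≤1 {_ ∷ _ ∷ _} ((a≢c ∷ _) ∷ _) all≡ = contradiction (all≡ (here refl) (there (here refl))) a≢c

∃-other-member : ∀ {xs : List ℕ} → Distinct xs → 2 ≤ length xs → ∀ b → ∃ λ y → y ∈ xs × y ≢ b
∃-other-member {_ ∷ []}    _                (s≤s ()) _
∃-other-member {a ∷ c ∷ _} ((a≢c ∷ _) ∷ _) _        b with a ≟ b
... | yes refl = c , there (here refl) , ≢-sym a≢c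
... | no a≢b   = a , here refl , a≢b

module _ {A B : Set} {R : A → B → Set} (R? : ∀ a b → Dec (R a b)) where

  private
    row : A → List B → ℕ
    row a bs = length (filter (R? a) bs)

    col : List A → B → ℕ
    col as b = length (filter (λ a → R? a b) as)

    add-left : ∀ x c t {s} → s ≡ c + t → x + s ≡ c + (x + t)
    add-left x c t refl = +-left-comm x c t

    count-∷ : ∀ a as bs → sum (map (col (a ∷ as)) bs) ≡ row a bs + sum (map (col as) bs)
    count-∷ a as []       = refl
    count-∷ a as (b ∷ bs) with R? a b
    ... | yes _ = cong suc (add-left (col as b) (row a bs) (sum (map (col as) bs)) (count-∷ a as bs))
    ... | no _  = add-left (col as b) (row a bs) (sum (map (col as) bs)) (count-∷ a as bs)

  double-counting : ∀ as bs →
    sum (map (λ a → length (filter (R? a) bs)) as) ≡ sum (map (λ b → length (filter (λ a → R? a b) as)) bs)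
  double-counting []       bs = sym (sum-zero bs)
    where
    sum-zero : ∀ (bs : List B) → sum (map (λ _ → 0) bs) ≡ 0
    sum-zero []       = refl
    sum-zero (_ ∷ bs) = sum-zero bs
  double-counting (a ∷ as) bs = trans (cong (_ +_) (double-counting as bs)) (sym (count-∷ a as bs))

<lex-irrefl : ∀ (u : Str) → ¬ u <lex u
<lex-irrefl u = <-irreflexive <-irrefl (Pointwise.refl refl)

<lex-trans : Transitive _<lex_
<lex-trans = <-transitive isEquivalence <-resp₂-≡ <-trans

take-between : ∀ k {u v w : Str} → u <lex v → v <lex w → take k u ≡ take k w → take k v ≡ take k u
take-between zero _ _ _ = refl
take-between (suc k) {w = []}    _               v<[]            _  = contradiction v<[] xs≮[]
take-between (suc k) {w = _ ∷ _} halt            _               ()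
take-between (suc k) {w = _ ∷ _} (this a<c)      (this c<e)      eq with refl ← proj₁ (∷-injective eq) =
  contradiction (<-trans a<c c<e) (<-irrefl refl)
take-between (suc k) {w = _ ∷ _} (this a<c)      (next refl _)   eq with refl ← proj₁ (∷-injective eq) =
  contradiction a<c (<-irrefl refl)
take-between (suc k) {w = _ ∷ _} (next refl _)   (this c<e)      eq with refl ← proj₁ (∷-injective eq) =
  contradiction c<e (<-irrefl refl)
take-between (suc k) {w = _ ∷ _} (next refl u<v) (next refl v<w) eq =
  cong (_ ∷_) (take-between k u<v v<w (proj₂ (∷-injective eq)))

data AllWindows {A : Set} (R : Maybe A → A → Maybe A → Set) : Maybe A → List A → Set where
  []  : ∀ {p} → AllWindows R p []
  _∷_ : ∀ {p b xs} → R p b (head xs) → AllWindows R (just b) xs → AllWindows R p (b ∷ xs)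

AllWindows-map : ∀ {A : Set} {R S : Maybe A → A → Maybe A → Set} →
  (∀ {p b q} → R p b q → S p b q) → ∀ {p xs} → AllWindows R p xs → AllWindows S p xs
AllWindows-map f []       = []
AllWindows-map f (r ∷ rs) = f r ∷ AllWindows-map f rs

differ : ℕ → ℕ → ℕ
differ a c with a ≟ c
... | yes _ = 0
... | no _  = 1

differ-≢ : ∀ {a c} → a ≢ c → 1 ≤ differ a c
differ-≢ {a} {c} a≢c with a ≟ c
... | yes a≡c = contradiction a≡c a≢c
... | no _    = ≤-refl

changes-∷ : ∀ a c cs → changes a (c ∷ cs) ≡ differ a c + changes c cs
changes-∷ a c cs with a ≟ c
... | yes _ = refl
... | no _  = refl

module RunCharging {A : Set} (ℓ : A → ℕ) where

  border : Maybe A → Maybe A → ℕ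
  border (just a) (just c) = differ (ℓ a) (ℓ c)
  border _        _        = 0

  Charged : (A → ℕ) → Maybe A → A → Maybe A → Set
  Charged w p b q = w b ≤ border p (just b) + border (just b) q

  private
    regroup : ∀ l e s → (l + e) + (e + 2 * s) ≡ l + 2 * (e + s)
    regroup = solve-∀

  charged-sum : ∀ {w p b xs} → AllWindows (Charged w) p (b ∷ xs) →
    sum (map w (b ∷ xs)) ≤ border p (just b) + 2 * changes (ℓ b) (map ℓ xs)
  charged-sum {w} {b = b} {[]} (wb ∷ []) = ≤-trans (≤-reflexive (+-identityʳ (w b))) wb
  charged-sum {w} {p} {b} {c ∷ xs} (wb ∷ ws) = begin
    w b + sum (map w (c ∷ xs))              ≤⟨ +-mono-≤ wb (charged-sum ws) ⟩
    (l + e) + (e + 2 * s)                   ≡⟨ regroup l e s ⟩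
    l + 2 * (e + s)                         ≡⟨ cong (λ m → l + 2 * m) (changes-∷ (ℓ b) (ℓ c) (map ℓ xs)) ⟨
    l + 2 * changes (ℓ b) (ℓ c ∷ map ℓ xs)  ∎
    where
    open ≤-Reasoning
    l e s : ℕ
    l = border p (just b)
    e = differ (ℓ b) (ℓ c)
    s = changes (ℓ c) (map ℓ xs)

  charged-sum< : ∀ {w xs} → AllWindows (Charged w) nothing xs → 0 < length xs →
    sum (map w xs) < 2 * runs (map ℓ xs)
  charged-sum< {w} {b ∷ xs} ws _ = begin-strict
    sum (map w (b ∷ xs))  ≤⟨ charged-sum ws ⟩
    2 * c                 <⟨ m<n+m (2 * c) {2} (s≤s z≤n) ⟩
    2 + 2 * c             ≡⟨ *-suc 2 c ⟨
    2 * suc c             ∎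
    where
    open ≤-Reasoning
    c : ℕ
    c = changes (ℓ b) (map ℓ xs)

module SortedWindows {A : Set} {_≺_ : A → A → Set} (≺-trans : Transitive _≺_) (U : List A) where

  _≼_ : A → A → Set
  a ≼ c = a ≡ c ⊎ a ≺ c

  record Window (p : Maybe A) (b : A) (q : Maybe A) : Set where
    field
      centre : b ∈ U
      pred   : AllMaybe (λ a → a ∈ U × a ≺ b) p
      succ   : AllMaybe (λ c → c ∈ U × b ≺ c) q
      split  : ∀ {y} → y ∈ U → y ≡ b ⊎ AnyMaybe (y ≼_) p ⊎ AnyMaybe (_≼ y) q

  private
    above-head : ∀ {c xs y} → Linked _≺_ (c ∷ xs) → y ∈ c ∷ xs → c ≼ y
    above-head _      (here refl)  = inj₁ refl
    above-head sorted (there y∈xs) with c≺xs ∷ _ ← Linked⇒AllPairs ≺-trans sorted =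
      inj₂ (All.lookup c≺xs y∈xs)

    below-centre : ∀ {p b y} → AllMaybe (λ a → a ∈ U × a ≺ b) p → AnyMaybe (y ≼_) p → y ≺ b
    below-centre (just (_ , a≺b)) (just (inj₁ refl)) = a≺b
    below-centre (just (_ , a≺b)) (just (inj₂ y≺a))  = ≺-trans y≺a a≺b

    window-split : ∀ {p b xs y} → Linked _≺_ (b ∷ xs) → y ∈ b ∷ xs ⊎ AnyMaybe (y ≼_) p →
      y ≡ b ⊎ AnyMaybe (y ≼_) p ⊎ AnyMaybe (_≼ y) (head xs)
    window-split _            (inj₁ (here y≡b))   = inj₁ y≡b
    window-split [-]          (inj₁ (there ()))
    window-split (_ ∷ sorted) (inj₁ (there y∈xs)) = inj₂ (inj₂ (just (above-head sorted y∈xs)))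
    window-split _            (inj₂ y≼p)          = inj₂ (inj₁ y≼p)

    window : ∀ {p b xs} → Linked _≺_ (b ∷ xs) → (∀ {y} → y ∈ b ∷ xs → y ∈ U) →
      AllMaybe (λ a → a ∈ U × a ≺ b) p → (∀ {y} → y ∈ U → y ∈ b ∷ xs ⊎ AnyMaybe (y ≼_) p) →
      Window p b (head xs)
    window {b = b} {xs} sorted ⊆U pred split =
      record { centre = ⊆U (here refl) ; pred = pred ; succ = succ sorted ; split = window-split sorted ∘ split }
      where
      succ : Linked _≺_ (b ∷ xs) → AllMaybe (λ c → c ∈ U × b ≺ c) (head xs)
      succ [-]       = nothing
      succ (b≺c ∷ _) = just (⊆U (there (here refl)) , b≺c)

    windows : ∀ {p b xs} → Linked _≺_ (b ∷ xs) → (∀ {y} → y ∈ b ∷ xs → y ∈ U) →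
      AllMaybe (λ a → a ∈ U × a ≺ b) p → (∀ {y} → y ∈ U → y ∈ b ∷ xs ⊎ AnyMaybe (y ≼_) p) →
      AllWindows Window p (b ∷ xs)
    windows {xs = []} sorted ⊆U pred split = window sorted ⊆U pred split ∷ []
    windows {b = b} {c ∷ xs} sorted@(b≺c ∷ sorted′) ⊆U pred split =
      window sorted ⊆U pred split ∷ windows sorted′ (⊆U ∘ there) (just (⊆U (here refl) , b≺c)) split′
      where
      split′ : ∀ {y} → y ∈ U → y ∈ c ∷ xs ⊎ AnyMaybe (y ≼_) (just b)
      split′ y∈U with split y∈U
      ... | inj₁ (here refl)  = inj₂ (just (inj₁ refl))
      ... | inj₁ (there y∈xs) = inj₁ y∈xs
      ... | inj₂ y≼p          = inj₂ (just (inj₂ (below-centre pred y≼p)))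

  sorted-windows : ∀ {xs} → Linked _≺_ xs → (∀ {y} → y ∈ xs → y ∈ U) → (∀ {y} → y ∈ U → y ∈ xs) →
    AllWindows Window nothing xs
  sorted-windows {[]}    _      _  _  = []
  sorted-windows {_ ∷ _} sorted ⊆U ⊇U = windows sorted ⊆U nothing (inj₁ ∘ ⊇U)

bwtChar : Str → ℕ → ℕ
bwtChar T i = charAt T (i ∸ 1)

drop-nth : ∀ k (T : Str) → k < length T → drop k T ≡ nth T k ∷ drop (suc k) T
drop-nth zero    (a ∷ T) _         = refl
drop-nth (suc k) (a ∷ T) (s≤s k<n) = drop-nth k T k<n

nth-init-∈ : ∀ (U : Str) c k → suc k < length (U ++ [ c ]) → nth (U ++ [ c ]) k ∈ U
nth-init-∈ []      c k       (s≤s ())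
nth-init-∈ (a ∷ U) c zero    _         = here refl
nth-init-∈ (a ∷ U) c (suc k) (s≤s k<n) = there (nth-init-∈ U c k k<n)

DollarOnlyLast : Str → Set
DollarOnlyLast T = ∀ k → suc k < length T → nth T k ≢ dollar

dollar-only-last : ∀ {T U} → T ≡ U ++ [ dollar ] → ¬ dollar ∈ U → DollarOnlyLast T
dollar-only-last {U = U} refl $∉U k k<n nth≡$ = $∉U (subst (_∈ U) nth≡$ (nth-init-∈ U dollar k k<n))

module Text (T : Str) where

  ∈-positions⁻ : ∀ {y} → y ∈ positions T → ∃ λ k → y ≡ suc k × k < length T
  ∈-positions⁻ y∈P with k , k∈ , refl ← ∈-map⁻ suc y∈P = k , refl , ∈-upTo⁻ k∈

  ∈-positions⁺ : ∀ {k} → k < length T → suc k ∈ positions T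
  ∈-positions⁺ k<n = ∈-map⁺ suc (∈-upTo⁺ k<n)

  positions-distinct : Distinct (positions T)
  positions-distinct = Distinct.map⁺ suc-injective (Distinct.upTo⁺ (length T))

  occAt-∷ : ∀ {k x} → k < length T → OccAt T x (2 + k) → OccAt T (nth T k ∷ x) (suc k)
  occAt-∷ {k} {x} k<n occ = trans (cong (take (suc (length x))) (drop-nth k T k<n)) (cong (nth T k ∷_) occ)

  occAt-head : ∀ {k c x} → k < length T → OccAt T (c ∷ x) (suc k) → nth T k ≡ c
  occAt-head {k} {x = x} k<n occ =
    proj₁ (∷-injective (trans (sym (cong (take (suc (length x))) (drop-nth k T k<n))) occ))

  occAt-first : ∀ {k c x} → k < length T → OccAt T (c ∷ x) (suc k) → OccAt T [ c ] (suc k)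
  occAt-first {k} k<n occ = subst (λ d → OccAt T [ d ] (suc k)) (occAt-head k<n occ) (occAt-∷ {x = []} k<n refl)

  occAt-length : ∀ {x b} → OccAt T x b → length x ≤ length T
  occAt-length {x} {b} occ = begin
    length x                                  ≡⟨ cong length occ ⟨
    length (take (length x) (drop (b ∸ 1) T)) ≡⟨ length-take (length x) _ ⟩
    length x ⊓ length (drop (b ∸ 1) T)        ≤⟨ m⊓n≤n _ _ ⟩
    length (drop (b ∸ 1) T)                   ≡⟨ length-drop (b ∸ 1) T ⟩
    length T ∸ (b ∸ 1)                        ≤⟨ m∸n≤m (length T) (b ∸ 1) ⟩
    length T                                  ∎
    where open ≤-Reasoning

  repeat-of-two : ∀ {x i j} → i ∈ positions T → j ∈ positions T → i ≢ j →
    OccAt T x i → OccAt T x j → Repeat T x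
  repeat-of-two {x} i∈P j∈P i≢j occ-i occ-j =
    2≤length (∈-filter⁺ (occAt? T x) i∈P occ-i) (∈-filter⁺ (occAt? T x) j∈P occ-j) i≢j

  repeat⇒¬unique : ∀ {x} → Repeat T x → ¬ Unique T x
  repeat⇒¬unique rep uniq with s≤s () ← subst (2 ≤_) uniq rep

  ∃-other-occurrence : ∀ {x} → Repeat T x → ∀ b → ∃ λ y → y ∈ positions T × OccAt T x y × y ≢ b
  ∃-other-occurrence {x} rep b
    with y , y∈Occ , y≢b ← ∃-other-member (Distinct.filter⁺ (occAt? T x) positions-distinct) rep b =
    let y∈P , occ = ∈-filter⁻ (occAt? T x) y∈Occ in y , y∈P , occ , y≢b

  covered-by-repeat : ∀ x b {y b′} → b′ ∈ positions T → OccAt T y b′ → Repeat T y →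
    b′ ≤ b → b + length x ≤ b′ + length y → b′ < b ⊎ b + length x < b′ + length y → Covered T x b
  covered-by-repeat x b {y} {b′} b′∈P occ rep start≤ ≤end strict =
    lose b′∈P (lose (∈-upTo⁺ (s≤s (occAt-length {b = b′} occ))) (occ′ , rep′ , start≤ , ≤end , strict))
    where
    occ′ : OccAt T (sub T b′ (length y)) b′
    occ′ = subst (λ z → OccAt T z b′) (sym occ) occ
    rep′ : Repeat T (sub T b′ (length y))
    rep′ = subst (Repeat T) (sym occ) rep

  longer-repeat-covers : ∀ x {y b} → b ∈ positions T → length x < length y →
    OccAt T y b → Repeat T y → Covered T x b
  longer-repeat-covers x {b = b} b∈P shorter occ rep =
    covered-by-repeat x b b∈P occ rep ≤-refl (+-monoʳ-≤ b (<⇒≤ shorter)) (inj₂ (+-monoʳ-< b shorter))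

  repeated-left-extension⇒¬net : ∀ {k x} → k < length T → Repeat T (nth T k ∷ x) → ¬ NetOcc T x (2 + k)
  repeated-left-extension⇒¬net {x = []} _ rep (_ , unique , _) = repeat⇒¬unique rep unique
  repeated-left-extension⇒¬net {k} {x@(_ ∷ _)} k<n rep (occ , ¬covered) =
    ¬covered (covered-by-repeat x (2 + k) (∈-positions⁺ k<n) (occAt-∷ k<n occ) rep (n≤1+n _)
                                (≤-reflexive (sym (+-suc (suc k) (length x)))) (inj₁ ≤-refl))

  ¬net-ε-inside-repeat : ∀ {b c x} → b ∈ positions T → Repeat T (c ∷ x) → OccAt T (c ∷ x) b →
    ¬ NetOcc T [] b
  ¬net-ε-inside-repeat {c = c} b∈P rep occ (_ , _ , unique)
    with k , refl , k<n ← ∈-positions⁻ b∈P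
    with y , y∈P , occ-y , y≢b ← ∃-other-occurrence rep (suc k)
    with k′ , refl , k′<n ← ∈-positions⁻ y∈P =
    repeat⇒¬unique {[ c ]} (repeat-of-two b∈P y∈P (≢-sym y≢b) (occAt-first k<n occ) (occAt-first k′<n occ-y))
                           (subst (λ d → Unique T [ d ]) (occAt-head k<n occ) unique)

  net-occurrence-unique : ∀ {x y b} → b ∈ positions T → Repeat T x → Repeat T y →
    NetOcc T x b → NetOcc T y b → x ≡ y
  net-occurrence-unique {[]}    {[]}    _   _     _     _           _           = refl
  net-occurrence-unique {[]}    {_ ∷ _} b∈P _     rep-y net-x       (occ-y , _) =
    contradiction net-x (¬net-ε-inside-repeat b∈P rep-y occ-y)
  net-occurrence-unique {_ ∷ _} {[]}    b∈P rep-x _     (occ-x , _) net-y       =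
    contradiction net-y (¬net-ε-inside-repeat b∈P rep-x occ-x)
  net-occurrence-unique {x@(_ ∷ _)} {y@(_ ∷ _)} {b} b∈P rep-x rep-y (occ-x , ¬cov-x) (occ-y , ¬cov-y)
    with <-cmp (length x) (length y)
  ... | tri< x<y _ _ = contradiction (longer-repeat-covers x b∈P x<y occ-y rep-y) ¬cov-x
  ... | tri> _ _ y<x = contradiction (longer-repeat-covers y b∈P y<x occ-x rep-x) ¬cov-y
  ... | tri≈ _ x≡y _ = trans (sym occ-x) (trans (cong (sub T b) x≡y) occ-y)

  netAt : ℕ → ℕ
  netAt b = length (filter (λ x → netOcc? T x b) (repeats T))

  ∈-repeats⁻ : ∀ {x} → x ∈ repeats T → Repeat T x
  ∈-repeats⁻ = proj₂ ∘ ∈-filter⁻ (repeat? T) {xs = substrings T}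

  netAt≤1 : ∀ {b} → b ∈ positions T → netAt b ≤ 1
  netAt≤1 {b} b∈P = length≤1 (Distinct.filter⁺ (λ x → netOcc? T x b) repeats-distinct) net-unique
    where
    repeats-distinct : Distinct (repeats T)
    repeats-distinct = Distinct.filter⁺ (repeat? T)
      (deduplicate-! (concatMap (λ b → map (sub T b) (upTo (suc (length T)))) (positions T)))
    net-unique : ∀ {x y} → x ∈ filter (λ x → netOcc? T x b) (repeats T) →
      y ∈ filter (λ x → netOcc? T x b) (repeats T) → x ≡ y
    net-unique x∈ y∈ =
      let x∈R , net-x = ∈-filter⁻ (λ x → netOcc? T x b) x∈
          y∈R , net-y = ∈-filter⁻ (λ x → netOcc? T x b) y∈
      in net-occurrence-unique b∈P (∈-repeats⁻ x∈R) (∈-repeats⁻ y∈R) net-x net-y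

  totalNF≡sum-netAt : ∀ {SA} → SA ↭ positions T → totalNF T ≡ sum (map netAt SA)
  totalNF≡sum-netAt {SA} SA↭P = begin
    totalNF T
      ≡⟨ cong sum (map-cong (λ x → ↭-length (filter-↭ (netOcc? T x) (↭-sym SA↭P))) (repeats T)) ⟩
    sum (map (λ x → length (filter (netOcc? T x) SA)) (repeats T))
      ≡⟨ double-counting (netOcc? T) (repeats T) SA ⟩
    sum (map netAt SA) ∎
    where open ≡-Reasoning

  _≺_ : ℕ → ℕ → Set
  i ≺ j = suffix T i <lex suffix T j

  ≺⇒≢ : ∀ {i j} → i ≺ j → i ≢ j
  ≺⇒≢ {i} i≺j refl = <lex-irrefl (suffix T i) i≺j

  occAt-between : ∀ {x u v w} → u ≺ v → v ≺ w → OccAt T x u → OccAt T x w → OccAt T x v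
  occAt-between {x} u≺v v≺w occ-u occ-w =
    trans (take-between (length x) u≺v v≺w (trans occ-u (sym occ-w))) occ-u

  open RunCharging (bwtChar T) public
  open SortedWindows {_≺_ = _≺_} <lex-trans (positions T) public

  module _ ($-last : DollarOnlyLast T) where

    net-occurrence-bwt-differs : ∀ {x b j} → b ∈ positions T → j ∈ positions T → j ≢ b →
      OccAt T x j → NetOcc T x b → bwtChar T j ≢ bwtChar T b
    net-occurrence-bwt-differs {x} b∈P j∈P j≢b occ-j net
      with b₀ , refl , b₀<n ← ∈-positions⁻ b∈P
      with j₀ , refl , j₀<n ← ∈-positions⁻ j∈P =
      differs b₀ j₀ b₀<n j₀<n (j≢b ∘ cong suc) occ-j net
      where
      differs : ∀ b₀ j₀ → b₀ < length T → j₀ < length T → j₀ ≢ b₀ →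
        OccAt T x (suc j₀) → NetOcc T x (suc b₀) → charAt T j₀ ≢ charAt T b₀
      differs zero     zero     _   _   j≢b _     _   = contradiction refl j≢b
      differs zero     (suc j₁) _   j<n _   _     _   = $-last j₁ j<n
      differs (suc b₁) zero     b<n _   _   _     _   = ≢-sym ($-last b₁ b<n)
      differs (suc b₁) (suc j₁) b<n j<n j≢b occ-j net same =
        repeated-left-extension⇒¬net (<⇒≤ b<n)
          (repeat-of-two (∈-positions⁺ (<⇒≤ b<n)) (∈-positions⁺ (<⇒≤ j<n)) (j≢b ∘ sym)
                         (occAt-∷ (<⇒≤ b<n) (proj₁ net))
                         (subst (λ c → OccAt T (c ∷ x) (suc j₁)) same (occAt-∷ (<⇒≤ j<n) occ-j)))
          net

    private
      border-below : ∀ {x p b y} → b ∈ positions T → AllMaybe (λ a → a ∈ positions T × a ≺ b) p →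
        AnyMaybe (y ≼_) p → OccAt T x y → NetOcc T x b → 1 ≤ border p (just b)
      border-below {x} {just a} {b} {y} b∈P (just (a∈P , a≺b)) (just y≼a) occ-y net =
        differ-≢ (net-occurrence-bwt-differs b∈P a∈P (≺⇒≢ a≺b) (occ-a y≼a) net)
        where
        occ-a : y ≼ a → OccAt T x a
        occ-a (inj₁ refl) = occ-y
        occ-a (inj₂ y≺a)  = occAt-between {x} {y} {a} {b} y≺a a≺b occ-y (proj₁ net)

      border-above : ∀ {x q b y} → b ∈ positions T → AllMaybe (λ c → c ∈ positions T × b ≺ c) q →
        AnyMaybe (_≼ y) q → OccAt T x y → NetOcc T x b → 1 ≤ border (just b) q
      border-above {x} {just c} {b} {y} b∈P (just (c∈P , b≺c)) (just c≼y) occ-y net =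
        differ-≢ (≢-sym (net-occurrence-bwt-differs b∈P c∈P (≢-sym (≺⇒≢ b≺c)) (occ-c c≼y) net))
        where
        occ-c : c ≼ y → OccAt T x c
        occ-c (inj₁ refl) = occ-y
        occ-c (inj₂ c≺y)  = occAt-between {x} {b} {c} {y} b≺c c≺y (proj₁ net) occ-y

    net-occurrence⇒border : ∀ {x p b q} → Window p b q → Repeat T x → NetOcc T x b →
      1 ≤ border p (just b) + border (just b) q
    net-occurrence⇒border {b = b} w rep net
      with y , y∈P , occ-y , y≢b ← ∃-other-occurrence rep b
      with Window.split w y∈P
    ... | inj₁ y≡b        = contradiction y≡b y≢b
    ... | inj₂ (inj₁ y≼p) =
      ≤-trans (border-below (Window.centre w) (Window.pred w) y≼p occ-y net) (m≤m+n _ _)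
    ... | inj₂ (inj₂ q≼y) =
      ≤-trans (border-above (Window.centre w) (Window.succ w) q≼y occ-y net) (m≤n+m _ _)

    netAt-charged : ∀ {p b q} → Window p b q → Charged netAt p b q
    netAt-charged {b = b} w with any? (λ x → netOcc? T x b) (repeats T)
    ... | yes ∃net = let _ , x∈R , net = find ∃net in
      ≤-trans (netAt≤1 (Window.centre w)) (net-occurrence⇒border w (∈-repeats⁻ x∈R) net)
    ... | no ∄net = ≤-trans (≤-reflexive (cong length none)) z≤n
      where
      none : filter (λ x → netOcc? T x b) (repeats T) ≡ []
      none = filter-none (λ x → netOcc? T x b) (¬Any⇒All¬ (repeats T) ∄net)

theorem1 : (σ : ℕ) (T : Str) (SA : List ℕ) → ValidText σ T → IsSuffixArray T SA →
    totalNF T < 2 * runs (BWT T SA)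
theorem1 _ T SA (n≥2 , _ , _ , _ , T≡U$ , $∉U) (SA↭P , sorted) = begin-strict
  totalNF T           ≡⟨ totalNF≡sum-netAt SA↭P ⟩
  sum (map netAt SA)  <⟨ charged-sum< (AllWindows-map (netAt-charged $-last) windows) SA-nonempty ⟩
  2 * runs (BWT T SA) ∎
  where
  open ≤-Reasoning
  open Text T
  $-last : DollarOnlyLast T
  $-last = dollar-only-last T≡U$ $∉U
  windows : AllWindows Window nothing SA
  windows = sorted-windows sorted (∈-resp-↭ SA↭P) (∈-resp-↭ (↭-sym SA↭P))
  SA-nonempty : 0 < length SA
  SA-nonempty = 0<length (∈-resp-↭ (↭-sym SA↭P) (∈-positions⁺ (≤-trans (s≤s z≤n) n≥2)))
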